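{- Let $G$ be a finite group with commutator subgroup $G'=[G,G]$, and let $a\in G$. Suppose $\langle a,G'\rangle=G$ and $G'$ is cyclic of square-free order. Then $a$ does not centralize any nontrivial subgroup of $G'$. -}

module Defs where

open import Level using (Level; _⊔_; Lift)
open import Data.Nat using (ℕ; _*_)
open import Data.Nat.Divisibility using (_∣_)
open import Data.Nat.Primality using (Prime)
open import Data.Fin using (Fin)
open import Data.Product using (Σ; ∃; _×_)
open import Data.Sum using (_⊎_)
open import Relation.Nullary using (¬_)
open import Relation.Binary.PropositionalEquality using (_≡_)
open import Algebra.Bundles using (Group)

SquareFree : ℕ → Set
SquareFree m = ∀ p → Prime p → ¬ (p * p ∣ m)

module GroupTheory {c ℓ : Level} (G : Group c ℓ) where
  open Group G

  Pred' : Set _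
  Pred' = Carrier → Set (c ⊔ ℓ)

  IsFinite : Set (c ⊔ ℓ)
  IsFinite = Σ ℕ λ n → Σ (Fin n → Carrier) λ e →
               (∀ i j → e i ≈ e j → i ≡ j) × (∀ x → ∃ λ i → e i ≈ x)

  HasSize : Pred' → ℕ → Set (c ⊔ ℓ)
  HasSize S m = Σ (Fin m → Carrier) λ e →
                  (∀ i → S (e i)) ×
                  (∀ i j → e i ≈ e j → i ≡ j) ×
                  (∀ x → S x → ∃ λ i → e i ≈ x)

  data ⟨_⟩ (S : Pred') : Pred' where
    gen  : ∀ {x} → S x → ⟨ S ⟩ x
    one  : ⟨ S ⟩ ε
    inv  : ∀ {x} → ⟨ S ⟩ x → ⟨ S ⟩ (x ⁻¹)
    mul  : ∀ {x y} → ⟨ S ⟩ x → ⟨ S ⟩ y → ⟨ S ⟩ (x ∙ y)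
    resp : ∀ {x y} → x ≈ y → ⟨ S ⟩ x → ⟨ S ⟩ y

  [_,_] : Carrier → Carrier → Carrier
  [ g , h ] = g ⁻¹ ∙ h ⁻¹ ∙ g ∙ h

  G′ : Pred'
  G′ = ⟨ (λ x → ∃ λ g → ∃ λ h → x ≈ [ g , h ]) ⟩

  record IsSubgroup (H : Pred') : Set (c ⊔ ℓ) where
    field
      ∈-resp : ∀ {x y} → x ≈ y → H x → H y
      ∈-ε    : H ε
      ∈-∙    : ∀ {x y} → H x → H y → H (x ∙ y)
      ∈-⁻¹   : ∀ {x} → H x → H (x ⁻¹)

  _⊆_ : Pred' → Pred' → Set (c ⊔ ℓ)
  A ⊆ B = ∀ {x} → A x → B x

  IsCyclic : Pred' → Set (c ⊔ ℓ)
  IsCyclic H = ∃ λ g → H g × (∀ x → H x → ⟨ (λ y → Lift c (y ≈ g)) ⟩ x)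

  Nontrivial : Pred' → Set (c ⊔ ℓ)
  Nontrivial H = ∃ λ h → H h × ¬ (h ≈ ε)

  Centralizes : Carrier → Pred' → Set (c ⊔ ℓ)
  Centralizes a H = ∀ h → H h → a ∙ h ≈ h ∙ a

  ⟨_,G′⟩ : Carrier → Pred'
  ⟨ a ,G′⟩ = ⟨ (λ y → Lift c (y ≈ a) ⊎ G′ y) ⟩

-- Let A = G′. Because A is abelian and normal, x ↦ [x , a] is an endomorphism of A,
-- and its image [A , a] is a subgroup of A normalised by a and by A, hence normal in
-- G = ⟨a , A⟩. Modulo [A , a] the generator a commutes with A, so G/[A , a] is abelian
-- and G′ ⊆ [A , a]; without quotients this is the statement that every commutator of
-- generators, and then every commutator, lies in [A , a]. Thus x ↦ [x , a] maps the
-- finite group G′ onto itself, so it is injective, and its kernel C_{G′}(a) is trivial.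
module Submission where

open import Level using (Lift; lift; lower; _⊔_)
open import Function using (_∘_)
open import Function.Definitions using (Injective)
open import Data.Nat using (ℕ; suc)
open import Data.Nat.Properties using (1+n≰n)
open import Data.Fin using (Fin; punchOut)
open import Data.Fin.Properties using (_≟_; any?; punchOut-injective; injective⇒≤)
open import Data.Product using (∃; _×_; _,_; proj₁; proj₂)
open import Data.Sum using (_⊎_; inj₁; inj₂)
open import Relation.Nullary using (¬_; yes; no; contradiction)
open import Relation.Binary.PropositionalEquality as ≡ using (_≡_)
open import Algebra.Bundles using (Group)
open import Tactic.MonoidSolver using (solve)
open import Defs

injective⇒surjective : ∀ {m} (f : Fin m → Fin m) → Injective _≡_ _≡_ f →
                       ∀ t → ∃ λ j → f j ≡ t
injective⇒surjective {suc m} f f-injective t with any? (λ j → f j ≟ t)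
... | yes hit  = hit
... | no  miss = contradiction (injective⇒≤ f′-injective) 1+n≰n
  where
  f′ : Fin (suc m) → Fin m
  f′ j = punchOut {i = t} {j = f j} (λ t≡fj → miss (j , ≡.sym t≡fj))

  f′-injective : Injective _≡_ _≡_ f′
  f′-injective = f-injective ∘ punchOut-injective {i = t} _ _

module Commutators {c ℓ} (G : Group c ℓ) where
  open Group G
  open GroupTheory G
  open import Algebra.Properties.Group G
  open import Relation.Binary.Reasoning.Setoid setoid

  ⟨⟩-isSubgroup : ∀ S → IsSubgroup ⟨ S ⟩
  ⟨⟩-isSubgroup S = record { ∈-resp = resp ; ∈-ε = one ; ∈-∙ = mul ; ∈-⁻¹ = inv }

  ⟨⟩-least : ∀ {S K} → IsSubgroup K → S ⊆ K → ⟨ S ⟩ ⊆ K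
  ⟨⟩-least K-subgroup S⊆K (gen x∈S)    = S⊆K x∈S
  ⟨⟩-least K-subgroup S⊆K one          = IsSubgroup.∈-ε K-subgroup
  ⟨⟩-least K-subgroup S⊆K (inv x∈⟨S⟩)  = IsSubgroup.∈-⁻¹ K-subgroup (⟨⟩-least K-subgroup S⊆K x∈⟨S⟩)
  ⟨⟩-least K-subgroup S⊆K (mul x∈⟨S⟩ y∈⟨S⟩) =
    IsSubgroup.∈-∙ K-subgroup (⟨⟩-least K-subgroup S⊆K x∈⟨S⟩) (⟨⟩-least K-subgroup S⊆K y∈⟨S⟩)
  ⟨⟩-least K-subgroup S⊆K (resp x≈y x∈⟨S⟩) =
    IsSubgroup.∈-resp K-subgroup x≈y (⟨⟩-least K-subgroup S⊆K x∈⟨S⟩)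

  Centralizer : Carrier → Pred'
  Centralizer x y = Lift c (x ∙ y ≈ y ∙ x)

  centralizer-isSubgroup : ∀ x → IsSubgroup (Centralizer x)
  centralizer-isSubgroup x = record
    { ∈-resp = λ { y≈z (lift xy≈yx) → lift (trans (∙-congˡ (sym y≈z)) (trans xy≈yx (∙-congʳ y≈z))) }
    ; ∈-ε    = lift (trans (identityʳ x) (sym (identityˡ x)))
    ; ∈-∙    = λ { {y} {z} (lift xy≈yx) (lift xz≈zx) → lift (begin
        x ∙ (y ∙ z)  ≈⟨ assoc x y z ⟨
        x ∙ y ∙ z    ≈⟨ ∙-congʳ xy≈yx ⟩
        y ∙ x ∙ z    ≈⟨ assoc y x z ⟩
        y ∙ (x ∙ z)  ≈⟨ ∙-congˡ xz≈zx ⟩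
        y ∙ (z ∙ x)  ≈⟨ assoc y z x ⟨
        y ∙ z ∙ x    ∎) }
    ; ∈-⁻¹   = λ { {y} (lift xy≈yx) → lift (begin
        x ∙ y ⁻¹                  ≈⟨ \\-leftDividesʳ y (x ∙ y ⁻¹) ⟨
        y ⁻¹ ∙ (y ∙ (x ∙ y ⁻¹))   ≈⟨ ∙-congˡ (assoc y x (y ⁻¹)) ⟨
        y ⁻¹ ∙ (y ∙ x ∙ y ⁻¹)     ≈⟨ ∙-congˡ (∙-congʳ xy≈yx) ⟨
        y ⁻¹ ∙ (x ∙ y ∙ y ⁻¹)     ≈⟨ ∙-congˡ (//-rightDividesʳ y x) ⟩
        y ⁻¹ ∙ x                  ∎) }
    }

  cyclic⇒commutative : ∀ {H} → IsCyclic H → ∀ {x y} → H x → H y → x ∙ y ≈ y ∙ x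
  cyclic⇒commutative (g , _ , generates) {x} {y} x∈H y∈H =
    lower (⟨⟩-least (centralizer-isSubgroup x) g-commutes-with-x (generates y y∈H))
    where
    g-commutes-with-⟨g⟩ : ⟨ (λ z → Lift c (z ≈ g)) ⟩ ⊆ Centralizer g
    g-commutes-with-⟨g⟩ = ⟨⟩-least (centralizer-isSubgroup g)
      (λ { (lift z≈g) → lift (trans (∙-congˡ z≈g) (∙-congʳ (sym z≈g))) })

    g-commutes-with-x : (λ z → Lift c (z ≈ g)) ⊆ Centralizer x
    g-commutes-with-x (lift z≈g) = lift (trans (∙-congˡ z≈g)
      (trans (sym (lower (g-commutes-with-⟨g⟩ (generates x x∈H)))) (∙-congʳ (sym z≈g))))

  infixl 7.5 _^_
  _^_ : Carrier → Carrier → Carrier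
  x ^ g = g ⁻¹ ∙ x ∙ g

  ^-cong : ∀ {x y g h} → x ≈ y → g ≈ h → x ^ g ≈ y ^ h
  ^-cong x≈y g≈h = ∙-cong (∙-cong (⁻¹-cong g≈h) x≈y) g≈h

  ^-identityʳ : ∀ x → x ^ ε ≈ x
  ^-identityʳ x = trans (identityʳ _) (trans (∙-congʳ ε⁻¹≈ε) (identityˡ x))

  ^-∙ : ∀ x g h → x ^ (g ∙ h) ≈ x ^ g ^ h
  ^-∙ x g h = begin
    (g ∙ h) ⁻¹ ∙ x ∙ (g ∙ h)    ≈⟨ ∙-congʳ (∙-congʳ (⁻¹-anti-homo-∙ g h)) ⟩
    h ⁻¹ ∙ g ⁻¹ ∙ x ∙ (g ∙ h)   ≈⟨ solve monoid ⟩
    h ⁻¹ ∙ (g ⁻¹ ∙ x ∙ g) ∙ h   ∎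

  ^-homo-∙ : ∀ x y g → (x ∙ y) ^ g ≈ x ^ g ∙ y ^ g
  ^-homo-∙ x y g = begin
    g ⁻¹ ∙ (x ∙ y) ∙ g                ≈⟨ solve monoid ⟩
    g ⁻¹ ∙ x ∙ (y ∙ g)                ≈⟨ ∙-congˡ (\\-leftDividesˡ g (y ∙ g)) ⟨
    g ⁻¹ ∙ x ∙ (g ∙ (g ⁻¹ ∙ (y ∙ g))) ≈⟨ solve monoid ⟩
    x ^ g ∙ y ^ g                     ∎

  ^-homo-⁻¹ : ∀ x g → x ⁻¹ ^ g ≈ (x ^ g) ⁻¹
  ^-homo-⁻¹ x g = inverseʳ-unique (x ^ g) (x ⁻¹ ^ g) (begin
    x ^ g ∙ x ⁻¹ ^ g   ≈⟨ ^-homo-∙ x (x ⁻¹) g ⟨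
    (x ∙ x ⁻¹) ^ g     ≈⟨ ^-cong (inverseʳ x) refl ⟩
    g ⁻¹ ∙ ε ∙ g       ≈⟨ ∙-congʳ (identityʳ (g ⁻¹)) ⟩
    g ⁻¹ ∙ g           ≈⟨ inverseˡ g ⟩
    ε                  ∎)

  commute⇒^-fixed : ∀ {x g} → x ∙ g ≈ g ∙ x → x ^ g ≈ x
  commute⇒^-fixed {x} {g} xg≈gx = begin
    g ⁻¹ ∙ x ∙ g          ≈⟨ assoc (g ⁻¹) x g ⟩
    g ⁻¹ ∙ (x ∙ g)        ≈⟨ ∙-congˡ xg≈gx ⟩
    g ⁻¹ ∙ (g ∙ x)        ≈⟨ \\-leftDividesʳ g x ⟩
    x                     ∎

  Normal : Pred' → Set (c ⊔ ℓ)
  Normal S = ∀ g {x} → S x → S (x ^ g)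

  Normalizer : Pred' → Pred'
  Normalizer S g = (∀ {x} → S x → S (x ^ g)) × (∀ {x} → S x → S (x ^ g ⁻¹))

  normalizer-isSubgroup : ∀ {S} → (∀ {x y} → x ≈ y → S x → S y) → IsSubgroup (Normalizer S)
  normalizer-isSubgroup {S} S-resp = record
    { ∈-resp = λ { g≈h (fwd , bwd) →
        S-resp (^-cong refl g≈h) ∘ fwd , S-resp (^-cong refl (⁻¹-cong g≈h)) ∘ bwd }
    ; ∈-ε    = S-resp (sym (^-identityʳ _)) ,
               S-resp (sym (trans (^-cong refl ε⁻¹≈ε) (^-identityʳ _)))
    ; ∈-∙    = λ { {g} {h} (g-fwd , g-bwd) (h-fwd , h-bwd) →
        (λ {x} x∈S → S-resp (sym (^-∙ x g h)) (h-fwd (g-fwd x∈S))) ,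
        (λ {x} x∈S → S-resp (sym (trans (^-cong refl (⁻¹-anti-homo-∙ g h)) (^-∙ x (h ⁻¹) (g ⁻¹))))
                            (g-bwd (h-bwd x∈S))) }
    ; ∈-⁻¹   = λ { {g} (fwd , bwd) → bwd , S-resp (^-cong refl (sym (⁻¹-involutive g))) ∘ fwd }
    }

  [,]-cong : ∀ {x y g h} → x ≈ y → g ≈ h → [ x , g ] ≈ [ y , h ]
  [,]-cong x≈y g≈h = ∙-cong (∙-cong (∙-cong (⁻¹-cong x≈y) (⁻¹-cong g≈h)) x≈y) g≈h

  [,]≈⁻¹∙^ : ∀ x g → [ x , g ] ≈ x ⁻¹ ∙ x ^ g
  [,]≈⁻¹∙^ x g = solve monoid

  ^≈∙[,] : ∀ x g → x ^ g ≈ x ∙ [ x , g ]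
  ^≈∙[,] x g = begin
    x ^ g                 ≈⟨ \\-leftDividesˡ x (x ^ g) ⟨
    x ∙ (x ⁻¹ ∙ x ^ g)    ≈⟨ ∙-congˡ ([,]≈⁻¹∙^ x g) ⟨
    x ∙ [ x , g ]         ∎

  commute⇒[,]≈ε : ∀ {x g} → x ∙ g ≈ g ∙ x → [ x , g ] ≈ ε
  commute⇒[,]≈ε {x} {g} xg≈gx = begin
    [ x , g ]         ≈⟨ [,]≈⁻¹∙^ x g ⟩
    x ⁻¹ ∙ x ^ g      ≈⟨ ∙-congˡ (commute⇒^-fixed xg≈gx) ⟩
    x ⁻¹ ∙ x          ≈⟨ inverseˡ x ⟩
    ε                 ∎

  [,]-⁻¹ : ∀ x g → [ x , g ] ⁻¹ ≈ [ g , x ]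
  [,]-⁻¹ x g = begin
    (x ⁻¹ ∙ g ⁻¹ ∙ x ∙ g) ⁻¹                ≈⟨ ⁻¹-anti-homo-∙ _ g ⟩
    g ⁻¹ ∙ (x ⁻¹ ∙ g ⁻¹ ∙ x) ⁻¹             ≈⟨ ∙-congˡ (⁻¹-anti-homo-∙ _ x) ⟩
    g ⁻¹ ∙ (x ⁻¹ ∙ (x ⁻¹ ∙ g ⁻¹) ⁻¹)        ≈⟨ ∙-congˡ (∙-congˡ (⁻¹-anti-homo-∙ _ _)) ⟩
    g ⁻¹ ∙ (x ⁻¹ ∙ (g ⁻¹ ⁻¹ ∙ x ⁻¹ ⁻¹))     ≈⟨ ∙-congˡ (∙-congˡ (∙-cong (⁻¹-involutive g) (⁻¹-involutive x))) ⟩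
    g ⁻¹ ∙ (x ⁻¹ ∙ (g ∙ x))                 ≈⟨ solve monoid ⟩
    [ g , x ]                               ∎

  [,]-∙ʳ : ∀ x g h → [ x , g ∙ h ] ≈ [ x , h ] ∙ [ x , g ] ^ h
  [,]-∙ʳ x g h = sym (begin
    [ x , h ] ∙ [ x , g ] ^ h                   ≈⟨ ∙-cong ([,]≈⁻¹∙^ x h) (^-cong ([,]≈⁻¹∙^ x g) refl) ⟩
    (x ⁻¹ ∙ x ^ h) ∙ (x ⁻¹ ∙ x ^ g) ^ h         ≈⟨ ∙-congˡ (^-homo-∙ (x ⁻¹) (x ^ g) h) ⟩
    (x ⁻¹ ∙ x ^ h) ∙ (x ⁻¹ ^ h ∙ x ^ g ^ h)     ≈⟨ ∙-congˡ (∙-congʳ (^-homo-⁻¹ x h)) ⟩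
    (x ⁻¹ ∙ x ^ h) ∙ ((x ^ h) ⁻¹ ∙ x ^ g ^ h)   ≈⟨ solve monoid ⟩
    x ⁻¹ ∙ (x ^ h ∙ ((x ^ h) ⁻¹ ∙ x ^ g ^ h))   ≈⟨ ∙-congˡ (\\-leftDividesˡ (x ^ h) (x ^ g ^ h)) ⟩
    x ⁻¹ ∙ x ^ g ^ h                            ≈⟨ ∙-congˡ (^-∙ x g h) ⟨
    x ⁻¹ ∙ x ^ (g ∙ h)                          ≈⟨ [,]≈⁻¹∙^ x (g ∙ h) ⟨
    [ x , g ∙ h ]                               ∎)

  [,]-⁻¹ʳ : ∀ x g → [ x , g ⁻¹ ] ≈ [ g , x ] ^ g ⁻¹
  [,]-⁻¹ʳ x g = sym (begin
    g ⁻¹ ⁻¹ ∙ [ g , x ] ∙ g ⁻¹               ≈⟨ ∙-congʳ (∙-congʳ (⁻¹-involutive g)) ⟩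
    g ∙ (g ⁻¹ ∙ x ⁻¹ ∙ g ∙ x) ∙ g ⁻¹         ≈⟨ solve monoid ⟩
    g ∙ (g ⁻¹ ∙ (x ⁻¹ ∙ g ∙ x ∙ g ⁻¹))       ≈⟨ \\-leftDividesˡ g _ ⟩
    x ⁻¹ ∙ g ∙ x ∙ g ⁻¹                      ≈⟨ ∙-congʳ (∙-congʳ (∙-congˡ (⁻¹-involutive g))) ⟨
    [ x , g ⁻¹ ]                             ∎)

  [,]-^ : ∀ x g h → [ x , g ] ^ h ≈ [ x ^ h , g ^ h ]
  [,]-^ x g h = begin
    (x ⁻¹ ∙ g ⁻¹ ∙ x ∙ g) ^ h               ≈⟨ ^-homo-∙ _ g h ⟩
    (x ⁻¹ ∙ g ⁻¹ ∙ x) ^ h ∙ g ^ h           ≈⟨ ∙-congʳ (^-homo-∙ _ x h) ⟩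
    (x ⁻¹ ∙ g ⁻¹) ^ h ∙ x ^ h ∙ g ^ h       ≈⟨ ∙-congʳ (∙-congʳ (^-homo-∙ _ _ h)) ⟩
    x ⁻¹ ^ h ∙ g ⁻¹ ^ h ∙ x ^ h ∙ g ^ h     ≈⟨ ∙-congʳ (∙-congʳ (∙-cong (^-homo-⁻¹ x h) (^-homo-⁻¹ g h))) ⟩
    [ x ^ h , g ^ h ]                       ∎

  Image : (Carrier → Carrier) → Pred' → Pred'
  Image φ A x = ∃ λ y → A y × x ≈ φ y

  image-isSubgroup : ∀ {A} (φ : Carrier → Carrier) → (∀ {x y} → x ≈ y → φ x ≈ φ y) →
    IsSubgroup A → (∀ {x y} → A x → A y → φ (x ∙ y) ≈ φ x ∙ φ y) → IsSubgroup (Image φ A)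
  image-isSubgroup {A} φ φ-cong A-isSubgroup φ-homo = record
    { ∈-resp = λ { u≈v (y , y∈A , u≈φy) → y , y∈A , trans (sym u≈v) u≈φy }
    ; ∈-ε    = ε , ∈-ε , sym φε≈ε
    ; ∈-∙    = λ { (x , x∈A , u≈φx) (y , y∈A , v≈φy) →
        x ∙ y , ∈-∙ x∈A y∈A , trans (∙-cong u≈φx v≈φy) (sym (φ-homo x∈A y∈A)) }
    ; ∈-⁻¹   = λ { (y , y∈A , u≈φy) →
        y ⁻¹ , ∈-⁻¹ y∈A , trans (⁻¹-cong u≈φy) (sym (φ-homo-⁻¹ y∈A)) }
    }
    where
    open IsSubgroup A-isSubgroup

    φε≈ε : φ ε ≈ ε
    φε≈ε = begin
      φ ε                        ≈⟨ //-rightDividesʳ (φ ε) (φ ε) ⟨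
      φ ε ∙ φ ε ∙ φ ε ⁻¹         ≈⟨ ∙-congʳ (φ-homo ∈-ε ∈-ε) ⟨
      φ (ε ∙ ε) ∙ φ ε ⁻¹         ≈⟨ ∙-congʳ (φ-cong (identityˡ ε)) ⟩
      φ ε ∙ φ ε ⁻¹               ≈⟨ inverseʳ (φ ε) ⟩
      ε                          ∎

    φ-homo-⁻¹ : ∀ {y} → A y → φ (y ⁻¹) ≈ φ y ⁻¹
    φ-homo-⁻¹ {y} y∈A = inverseʳ-unique (φ y) (φ (y ⁻¹)) (begin
      φ y ∙ φ (y ⁻¹)   ≈⟨ φ-homo y∈A (∈-⁻¹ y∈A) ⟨
      φ (y ∙ y ⁻¹)     ≈⟨ φ-cong (inverseʳ y) ⟩
      φ ε              ≈⟨ φε≈ε ⟩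
      ε                ∎)

  normal⇒[,]∈ : ∀ {A} → IsSubgroup A → Normal A → ∀ {x} g → A x → A [ x , g ]
  normal⇒[,]∈ A-isSubgroup A-normal {x} g x∈A =
    ∈-resp (sym ([,]≈⁻¹∙^ x g)) (∈-∙ (∈-⁻¹ x∈A) (A-normal g x∈A))
    where open IsSubgroup A-isSubgroup

  G′-normal : Normal G′
  G′-normal g {x} x∈G′ = resp (sym (^≈∙[,] x g)) (mul x∈G′ (gen (x , g , refl)))

  surjectiveOn⇒injectiveOn : ∀ {S m} → HasSize S m →
    (φ : Carrier → Carrier) → (∀ {x y} → x ≈ y → φ x ≈ φ y) →
    (∀ {x} → S x → ∃ λ y → S y × x ≈ φ y) →
    ∀ {x y} → S x → S y → φ x ≈ φ y → x ≈ y
  surjectiveOn⇒injectiveOn {S} {m} (e , e∈S , e-injective , e-onto) φ φ-cong φ-onto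
                           {x} {y} x∈S y∈S φx≈φy =
    conclude (through-section x∈S) (through-section y∈S)
    where
    section : Fin m → Fin m
    section j = proj₁ (e-onto _ (proj₁ (proj₂ (φ-onto (e∈S j)))))

    e≈φ∘e∘section : ∀ j → e j ≈ φ (e (section j))
    e≈φ∘e∘section j with y , y∈S , ej≈φy ← φ-onto (e∈S j) =
      trans ej≈φy (φ-cong (sym (proj₂ (e-onto y y∈S))))

    section-injective : Injective _≡_ _≡_ section
    section-injective {i} {j} si≡sj = e-injective i j (begin
      e i                ≈⟨ e≈φ∘e∘section i ⟩
      φ (e (section i))  ≡⟨ ≡.cong (φ ∘ e) si≡sj ⟩
      φ (e (section j))  ≈⟨ e≈φ∘e∘section j ⟨
      e j                ∎)

    through-section : ∀ {z} → S z → ∃ λ j → z ≈ e (section j) × φ z ≈ e j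
    through-section {z} z∈S with i , ei≈z ← e-onto z z∈S
                             with j , sj≡i ← injective⇒surjective section section-injective i =
      j , z≈esj , trans (φ-cong z≈esj) (sym (e≈φ∘e∘section j))
      where
      z≈esj : z ≈ e (section j)
      z≈esj = trans (sym ei≈z) (reflexive (≡.cong e (≡.sym sj≡i)))

    conclude : (∃ λ j → x ≈ e (section j) × φ x ≈ e j) →
               (∃ λ j → y ≈ e (section j) × φ y ≈ e j) → x ≈ y
    conclude (jx , x≈e∘section , φx≈e) (jy , y≈e∘section , φy≈e) = begin
      x               ≈⟨ x≈e∘section ⟩
      e (section jx)  ≡⟨ ≡.cong (e ∘ section) jx≡jy ⟩
      e (section jy)  ≈⟨ y≈e∘section ⟨
      y               ∎
      where
      jx≡jy : jx ≡ jy
      jx≡jy = e-injective jx jy (trans (sym φx≈e) (trans φx≈φy φy≈e))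

  module GeneratedOverAbelianNormal
    (A : Pred') (A-isSubgroup : IsSubgroup A) (A-normal : Normal A)
    (A-commutative : ∀ {x y} → A x → A y → x ∙ y ≈ y ∙ x)
    (a : Carrier) (generated : ∀ g → ⟨ (λ y → Lift c (y ≈ a) ⊎ A y) ⟩ g) where

    Generator : Pred'
    Generator y = Lift c (y ≈ a) ⊎ A y

    [A,a] : Pred'
    [A,a] = Image (λ y → [ y , a ]) A

    [-,a]-homo : ∀ {x y} → A x → A y → [ x ∙ y , a ] ≈ [ x , a ] ∙ [ y , a ]
    [-,a]-homo {x} {y} x∈A y∈A = sym (begin
      [ x , a ] ∙ [ y , a ]              ≈⟨ ∙-cong ([,]≈⁻¹∙^ x a) ([,]≈⁻¹∙^ y a) ⟩
      (x ⁻¹ ∙ x ^ a) ∙ (y ⁻¹ ∙ y ^ a)    ≈⟨ assoc _ _ _ ⟨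
      (x ⁻¹ ∙ x ^ a) ∙ y ⁻¹ ∙ y ^ a      ≈⟨ ∙-congʳ (A-commutative [x,a]∈A y⁻¹∈A) ⟩
      y ⁻¹ ∙ (x ⁻¹ ∙ x ^ a) ∙ y ^ a      ≈⟨ solve monoid ⟩
      (y ⁻¹ ∙ x ⁻¹) ∙ (x ^ a ∙ y ^ a)    ≈⟨ ∙-cong (⁻¹-anti-homo-∙ x y) (^-homo-∙ x y a) ⟨
      (x ∙ y) ⁻¹ ∙ (x ∙ y) ^ a           ≈⟨ [,]≈⁻¹∙^ (x ∙ y) a ⟨
      [ x ∙ y , a ]                      ∎)
      where
      [x,a]∈A : A (x ⁻¹ ∙ x ^ a)
      [x,a]∈A = IsSubgroup.∈-resp A-isSubgroup ([,]≈⁻¹∙^ x a)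
                  (normal⇒[,]∈ A-isSubgroup A-normal a x∈A)

      y⁻¹∈A : A (y ⁻¹)
      y⁻¹∈A = IsSubgroup.∈-⁻¹ A-isSubgroup y∈A

    [A,a]-isSubgroup : IsSubgroup [A,a]
    [A,a]-isSubgroup =
      image-isSubgroup (λ y → [ y , a ]) (λ x≈y → [,]-cong x≈y refl) A-isSubgroup [-,a]-homo

    open IsSubgroup [A,a]-isSubgroup

    [A,a]⊆A : [A,a] ⊆ A
    [A,a]⊆A (y , y∈A , x≈[y,a]) =
      IsSubgroup.∈-resp A-isSubgroup (sym x≈[y,a]) (normal⇒[,]∈ A-isSubgroup A-normal a y∈A)

    ^-preserves-[A,a] : ∀ {h} → a ∙ h ≈ h ∙ a → ∀ {k} → [A,a] k → [A,a] (k ^ h)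
    ^-preserves-[A,a] {h} ah≈ha {k} (y , y∈A , k≈[y,a]) = y ^ h , A-normal h y∈A , (begin
      k ^ h              ≈⟨ ^-cong k≈[y,a] refl ⟩
      [ y , a ] ^ h      ≈⟨ [,]-^ y a h ⟩
      [ y ^ h , a ^ h ]  ≈⟨ [,]-cong refl (commute⇒^-fixed ah≈ha) ⟩
      [ y ^ h , a ]      ∎)

    [A,a]-normal : Normal [A,a]
    [A,a]-normal g =
      proj₁ (⟨⟩-least (normalizer-isSubgroup ∈-resp) generator-normalizes (generated g))
      where
      fixed-by : ∀ {z} → A z → ∀ {k} → [A,a] k → [A,a] (k ^ z)
      fixed-by z∈A k∈[A,a] =
        ∈-resp (sym (commute⇒^-fixed (A-commutative ([A,a]⊆A k∈[A,a]) z∈A))) k∈[A,a]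

      generator-normalizes : Generator ⊆ Normalizer [A,a]
      generator-normalizes (inj₁ (lift g≈a)) =
        IsSubgroup.∈-resp (normalizer-isSubgroup ∈-resp) (sym g≈a)
          (^-preserves-[A,a] refl , ^-preserves-[A,a] (trans (inverseʳ a) (sym (inverseˡ a))))
      generator-normalizes (inj₂ z∈A) = fixed-by z∈A , fixed-by (IsSubgroup.∈-⁻¹ A-isSubgroup z∈A)

    [A,a]-flip : ∀ {x h} → [A,a] [ x , h ] → [A,a] [ h , x ]
    [A,a]-flip {x} {h} [x,h]∈[A,a] = ∈-resp ([,]-⁻¹ x h) (∈-⁻¹ [x,h]∈[A,a])

    commute⇒[,]∈[A,a] : ∀ {x h} → x ∙ h ≈ h ∙ x → [A,a] [ x , h ]
    commute⇒[,]∈[A,a] xh≈hx = ∈-resp (sym (commute⇒[,]≈ε xh≈hx)) ∈-ε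

    [,]∈[A,a]-isSubgroup : ∀ x → IsSubgroup (λ h → [A,a] [ x , h ])
    [,]∈[A,a]-isSubgroup x = record
      { ∈-resp = λ g≈h → ∈-resp ([,]-cong refl g≈h)
      ; ∈-ε    = commute⇒[,]∈[A,a] (trans (identityʳ x) (sym (identityˡ x)))
      ; ∈-∙    = λ {g} {h} [x,g]∈ [x,h]∈ →
          ∈-resp (sym ([,]-∙ʳ x g h)) (∈-∙ [x,h]∈ ([A,a]-normal h [x,g]∈))
      ; ∈-⁻¹   = λ {g} [x,g]∈ →
          ∈-resp (sym ([,]-⁻¹ʳ x g)) ([A,a]-normal (g ⁻¹) ([A,a]-flip [x,g]∈))
      }

    generators-[,]∈[A,a] : ∀ {x h} → Generator x → Generator h → [A,a] [ x , h ]
    generators-[,]∈[A,a] (inj₁ (lift x≈a)) (inj₁ (lift h≈a)) =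
      commute⇒[,]∈[A,a] (trans (∙-cong x≈a h≈a) (sym (∙-cong h≈a x≈a)))
    generators-[,]∈[A,a] (inj₁ x≈a) (inj₂ h∈A) =
      [A,a]-flip (generators-[,]∈[A,a] (inj₂ h∈A) (inj₁ x≈a))
    generators-[,]∈[A,a] (inj₂ x∈A) (inj₁ (lift h≈a)) = _ , x∈A , [,]-cong refl h≈a
    generators-[,]∈[A,a] (inj₂ x∈A) (inj₂ h∈A) = commute⇒[,]∈[A,a] (A-commutative x∈A h∈A)

    [,]∈[A,a] : ∀ g h → [A,a] [ g , h ]
    [,]∈[A,a] g h = ⟨⟩-least ([,]∈[A,a]-isSubgroup g) [g,generator]∈[A,a] (generated h)
      where
      [g,generator]∈[A,a] : ∀ {y} → Generator y → [A,a] [ g , y ]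
      [g,generator]∈[A,a] y∈gen =
        [A,a]-flip (⟨⟩-least ([,]∈[A,a]-isSubgroup _) (generators-[,]∈[A,a] y∈gen) (generated g))

    G′⊆[A,a] : G′ ⊆ [A,a]
    G′⊆[A,a] = ⟨⟩-least [A,a]-isSubgroup
      (λ { (g , h , x≈[g,h]) → ∈-resp (sym x≈[g,h]) ([,]∈[A,a] g h) })

corollary2p20 : ∀ {c ℓ} (G : Group c ℓ) → let open GroupTheory G in
    IsFinite → (a : Group.Carrier G) →
    (∀ x → ⟨ a ,G′⟩ x) →
    IsCyclic G′ → (m : ℕ) → HasSize G′ m → SquareFree m →
    (H : Pred') → IsSubgroup H → H ⊆ G′ → Nontrivial H →
    ¬ Centralizes a H
corollary2p20 G _ a generated G′-cyclic _ G′-size _ _ _ H⊆G′ (h , h∈H , h≉ε) a-centralizes-H =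
  h≉ε (surjectiveOn⇒injectiveOn G′-size (λ y → [ y , a ]) (λ y≈z → [,]-cong y≈z refl)
         G′⊆[A,a] (H⊆G′ h∈H) one [h,a]≈[ε,a])
  where
  open Group G
  open GroupTheory G
  open Commutators G
  open GeneratedOverAbelianNormal G′ (⟨⟩-isSubgroup _) G′-normal (cyclic⇒commutative G′-cyclic)
                                  a generated

  [h,a]≈[ε,a] : [ h , a ] ≈ [ ε , a ]
  [h,a]≈[ε,a] = trans (commute⇒[,]≈ε (sym (a-centralizes-H h h∈H)))
                      (sym (commute⇒[,]≈ε (trans (identityˡ a) (sym (identityʳ a)))))
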